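{- If there exists a Hadamard matrix of order $n\ge8$, then there exists a pair of weakly unbiased Hadamard matrices $H,K$ of order $n$ with $\sigma(H,K)=\{2,n-2\}$.
   Context: A Hadamard matrix of order $n$ is an $n\times n$ $(\pm1)$-matrix $H$ with $HH^T=nI_n$. For Hadamard matrices $H,K$ with $a_{ij}$ the $(i,j)$-entry of $HK^T$, $\sigma(H,K)=\{|a_{ij}|: i,j\}$. $H,K$ are weakly unbiased if $a_{ij}\equiv2\pmod4$ for all $i,j$ and $|\sigma(H,K)|\le2$, unbiased pairs (all $|a_{ij}|=\sqrt n$) being excluded. -}

module Defs where

open import Data.Nat as ℕ using (ℕ; suc; _∸_)
open import Data.Integer as ℤ using (ℤ; +_; -[1+_]; ∣_∣)
open import Data.Fin using (Fin)
open import Data.Product using (Σ; _×_; ∃; ∃-syntax; _,_)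
open import Data.Sum using (_⊎_)
open import Relation.Binary.PropositionalEquality using (_≡_)
open import Relation.Nullary using (¬_; yes; no)
open import Data.Fin using (_≟_)
open import Data.Vec.Functional using (Vector; foldr)
open import Data.List using (List; length)
open import Data.List.Relation.Unary.Unique.Propositional using (Unique)
open import Data.List.Membership.Propositional using (_∈_)

Matrix : ℕ → Set
Matrix n = Fin n → Fin n → ℤ

Σℤ : ∀ {n} → (Fin n → ℤ) → ℤ
Σℤ v = foldr ℤ._+_ (+ 0) v

mulT : ∀ {n} → Matrix n → Matrix n → Matrix n
mulT M N i j = Σℤ (λ k → M i k ℤ.* N j k)

δ : ∀ {n} → Fin n → Fin n → ℤ
δ i j with i ≟ j
... | yes _ = + 1
... | no _ = + 0

IsPM1 : ℤ → Set
IsPM1 a = (a ≡ + 1) ⊎ (a ≡ ℤ.- (+ 1))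

IsHadamard : (n : ℕ) → Matrix n → Set
IsHadamard n H =
  (∀ i j → IsPM1 (H i j)) ×
  (∀ i j → mulT H H i j ≡ (+ n) ℤ.* δ i j)

Inσ : ∀ {n} → Matrix n → Matrix n → ℕ → Set
Inσ H K s = ∃[ i ] ∃[ j ] (∣ mulT H K i j ∣ ≡ s)

CardσLe2 : ∀ {n} → Matrix n → Matrix n → Set
CardσLe2 H K = ∀ (xs : List ℕ) → Unique xs →
  (∀ {s} → s ∈ xs → Inσ H K s) → length xs ℕ.≤ 2

-- Unbiased: all |a_ij| = √n, i.e. |a_ij|² = n.
Unbiased : ∀ {n} → Matrix n → Matrix n → Set
Unbiased {n} H K = ∀ i j → ∣ mulT H K i j ∣ ℕ.* ∣ mulT H K i j ∣ ≡ n

WeaklyUnbiased : (n : ℕ) → Matrix n → Matrix n → Set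
WeaklyUnbiased n H K =
  IsHadamard n H × IsHadamard n K ×
  (∀ i j → ∃[ k ] (mulT H K i j ≡ (+ 4) ℤ.* k ℤ.+ (+ 2))) ×
  CardσLe2 H K ×
  ¬ Unbiased H K

σEqPair : ∀ {n} → Matrix n → Matrix n → ℕ → ℕ → Set
σEqPair H K a b = ∀ s → (Inσ H K s → (s ≡ a ⊎ s ≡ b)) × ((s ≡ a ⊎ s ≡ b) → Inσ H K s)

-- Negating the first column of a Hadamard matrix H of order n gives a Hadamard
-- matrix K with H Kᵀ = n I − 2 c cᵀ, where c is the first column of H: the
-- diagonal entries equal n − 2 and the off-diagonal ones ±2.  Both are ≡ 2 mod 4
-- because the order of a Hadamard matrix with three rows is divisible by 4
-- (expand Σₖ (h₀ₖ + h₁ₖ)(h₀ₖ + h₂ₖ) = n, each summand being 0 or 4), and the pair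
-- is not unbiased since 2² ≠ n.
module Submission where

open import Defs
open import Data.Nat as ℕ using (ℕ; _≤_; _∸_; suc; s≤s; z≤n)
open import Data.Integer as ℤ using (ℤ; +_; -[1+_]; ∣_∣; _+_; _*_; -_; _-_)
open import Data.Integer.Properties as ℤ using ()
open import Data.Integer.Tactic.RingSolver using (solve-∀)
open import Algebra.Properties.Semiring.Sum ℤ.+-*-semiring
  using (sum-cong-≗; ∑-distrib-+; *-distribˡ-sum)
open import Data.Fin using (Fin; zero; suc; _≟_)
open import Data.Product using (_×_; ∃-syntax; _,_; proj₁; proj₂; map₂)
open import Data.Sum using (_⊎_; inj₁; inj₂)
open import Data.Empty using (⊥; ⊥-elim)
open import Function using (_∘_)
open import Data.List using (List; []; _∷_; length)
open import Data.List.Relation.Unary.Any using (here; there)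
open import Data.List.Relation.Unary.All using (_∷_)
open import Data.List.Relation.Unary.AllPairs using (_∷_)
open import Data.List.Relation.Unary.Unique.Propositional using (Unique)
open import Data.List.Membership.Propositional using (_∈_)
open import Relation.Nullary using (¬_; yes; no)
open import Relation.Binary.PropositionalEquality
open ≡-Reasoning

δ-refl : ∀ {n} (i : Fin n) → δ i i ≡ + 1
δ-refl i with i ≟ i
... | yes _ = refl
... | no i≢i = ⊥-elim (i≢i refl)

δ-≢ : ∀ {n} (i j : Fin n) → ¬ i ≡ j → δ i j ≡ + 0
δ-≢ i j i≢j with i ≟ j
... | yes i≡j = ⊥-elim (i≢j i≡j)
... | no _ = refl

IsPM1-* : ∀ {a b} → IsPM1 a → IsPM1 b → IsPM1 (a * b)
IsPM1-* (inj₁ refl) (inj₁ refl) = inj₁ refl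
IsPM1-* (inj₁ refl) (inj₂ refl) = inj₂ refl
IsPM1-* (inj₂ refl) (inj₁ refl) = inj₂ refl
IsPM1-* (inj₂ refl) (inj₂ refl) = inj₁ refl

IsPM1-- : ∀ {a} → IsPM1 a → IsPM1 (- a)
IsPM1-- (inj₁ refl) = inj₂ refl
IsPM1-- (inj₂ refl) = inj₁ refl

IsPM1⇒square≡1 : ∀ {a} → IsPM1 a → a * a ≡ + 1
IsPM1⇒square≡1 (inj₁ refl) = refl
IsPM1⇒square≡1 (inj₂ refl) = refl

MultipleOf : ℤ → ℤ → Set
MultipleOf d x = ∃[ t ] (x ≡ d * t)

Σℤ-multiple : ∀ {n} d (f : Fin n → ℤ) → (∀ k → MultipleOf d (f k)) →
              MultipleOf d (Σℤ f)
Σℤ-multiple d f f≡d*t = Σℤ t , (begin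
    Σℤ f              ≡⟨ sum-cong-≗ (λ k → proj₂ (f≡d*t k)) ⟩
    Σℤ (λ k → d * t k) ≡⟨ *-distribˡ-sum d t ⟨
    d * Σℤ t          ∎)
  where
  t : Fin _ → ℤ
  t k = proj₁ (f≡d*t k)

IsPM1⇒4∣[a+b][a+c] : ∀ {a b c} → IsPM1 a → IsPM1 b → IsPM1 c →
                     MultipleOf (+ 4) ((a + b) * (a + c))
IsPM1⇒4∣[a+b][a+c] (inj₁ refl) (inj₁ refl) (inj₁ refl) = + 1 , refl
IsPM1⇒4∣[a+b][a+c] (inj₁ refl) (inj₁ refl) (inj₂ refl) = + 0 , refl
IsPM1⇒4∣[a+b][a+c] (inj₁ refl) (inj₂ refl) _           = + 0 , refl
IsPM1⇒4∣[a+b][a+c] (inj₂ refl) (inj₁ refl) _           = + 0 , refl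
IsPM1⇒4∣[a+b][a+c] (inj₂ refl) (inj₂ refl) (inj₁ refl) = + 0 , refl
IsPM1⇒4∣[a+b][a+c] (inj₂ refl) (inj₂ refl) (inj₂ refl) = + 1 , refl

Σℤ-[u+v]*[u+w] : ∀ {n} (u v w : Fin n → ℤ) →
  Σℤ (λ k → (u k + v k) * (u k + w k)) ≡
  (Σℤ (λ k → u k * u k) + Σℤ (λ k → u k * w k)) +
  (Σℤ (λ k → v k * u k) + Σℤ (λ k → v k * w k))
Σℤ-[u+v]*[u+w] u v w = begin
  Σℤ (λ k → (u k + v k) * (u k + w k))
    ≡⟨ sum-cong-≗ (λ k → expand (u k) (v k) (w k)) ⟩
  Σℤ (λ k → (u k * u k + u k * w k) + (v k * u k + v k * w k))
    ≡⟨ ∑-distrib-+ (λ k → u k * u k + u k * w k) (λ k → v k * u k + v k * w k) ⟩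
  Σℤ (λ k → u k * u k + u k * w k) + Σℤ (λ k → v k * u k + v k * w k)
    ≡⟨ cong₂ _+_ (∑-distrib-+ (λ k → u k * u k) (λ k → u k * w k))
                 (∑-distrib-+ (λ k → v k * u k) (λ k → v k * w k)) ⟩
  (Σℤ (λ k → u k * u k) + Σℤ (λ k → u k * w k)) +
  (Σℤ (λ k → v k * u k) + Σℤ (λ k → v k * w k)) ∎
  where
  expand : ∀ a b c → (a + b) * (a + c) ≡ (a * a + a * c) + (b * a + b * c)
  expand = solve-∀

IsHadamard⇒4∣order : ∀ m {H : Matrix (3 ℕ.+ m)} → IsHadamard (3 ℕ.+ m) H →
                     MultipleOf (+ 4) (+ (3 ℕ.+ m))
IsHadamard⇒4∣order m {H} (±1 , orthogonal) =
  subst (MultipleOf (+ 4)) rowSum≡n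
    (Σℤ-multiple (+ 4) _ λ k → IsPM1⇒4∣[a+b][a+c] (±1 r₀ k) (±1 r₁ k) (±1 r₂ k))
  where
  n : ℤ
  n = + (3 ℕ.+ m)
  r₀ r₁ r₂ : Fin (3 ℕ.+ m)
  r₀ = zero
  r₁ = suc zero
  r₂ = suc (suc zero)
  rowSum≡n : Σℤ (λ k → (H r₀ k + H r₁ k) * (H r₀ k + H r₂ k)) ≡ n
  rowSum≡n = begin
    Σℤ (λ k → (H r₀ k + H r₁ k) * (H r₀ k + H r₂ k))
      ≡⟨ Σℤ-[u+v]*[u+w] (H r₀) (H r₁) (H r₂) ⟩
    (mulT H H r₀ r₀ + mulT H H r₀ r₂) + (mulT H H r₁ r₀ + mulT H H r₁ r₂)
      ≡⟨ cong₂ _+_ (cong₂ _+_ (orthogonal r₀ r₀) (orthogonal r₀ r₂))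
                   (cong₂ _+_ (orthogonal r₁ r₀) (orthogonal r₁ r₂)) ⟩
    (n * δ r₀ r₀ + n * δ r₀ r₂) + (n * δ r₁ r₀ + n * δ r₁ r₂)
      ≡⟨ cong₂ _+_ (cong₂ _+_ (cong (n *_) (δ-refl r₀)) (cong (n *_) (δ-≢ r₀ r₂ λ ())))
                   (cong₂ _+_ (cong (n *_) (δ-≢ r₁ r₀ λ ())) (cong (n *_) (δ-≢ r₁ r₂ λ ()))) ⟩
    (n * + 1 + n * + 0) + (n * + 0 + n * + 0)
      ≡⟨ simplify n ⟩
    n ∎
    where
    simplify : ∀ x → (x * + 1 + x * + 0) + (x * + 0 + x * + 0) ≡ x
    simplify = solve-∀

negateFirstColumn : ∀ {m} → Matrix (suc m) → Matrix (suc m)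
negateFirstColumn M i zero    = - M i zero
negateFirstColumn M i (suc k) = M i (suc k)

mulT-negateFirstColumn : ∀ {m} (M N : Matrix (suc m)) i j →
  mulT (negateFirstColumn M) (negateFirstColumn N) i j ≡ mulT M N i j
mulT-negateFirstColumn M N i j =
  cong (_+ Σℤ (λ k → M i (suc k) * N j (suc k))) (negate-both (M i zero) (N j zero))
  where
  negate-both : ∀ a b → - a * - b ≡ a * b
  negate-both = solve-∀

mulT-negateFirstColumnʳ : ∀ {m} (M N : Matrix (suc m)) i j →
  mulT M (negateFirstColumn N) i j ≡ mulT M N i j - + 2 * (M i zero * N j zero)
mulT-negateFirstColumnʳ M N i j =
  negate-one (M i zero) (N j zero) (Σℤ (λ k → M i (suc k) * N j (suc k)))
  where
  negate-one : ∀ a b r → a * - b + r ≡ (a * b + r) - + 2 * (a * b)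
  negate-one = solve-∀

negateFirstColumn-isHadamard : ∀ {m} {H : Matrix (suc m)} → IsHadamard (suc m) H →
                               IsHadamard (suc m) (negateFirstColumn H)
negateFirstColumn-isHadamard {m} {H} (±1 , orthogonal) = ±1′ , orthogonal′
  where
  ±1′ : ∀ i j → IsPM1 (negateFirstColumn H i j)
  ±1′ i zero    = IsPM1-- (±1 i zero)
  ±1′ i (suc j) = ±1 i (suc j)
  orthogonal′ : ∀ i j → mulT (negateFirstColumn H) (negateFirstColumn H) i j ≡ + suc m * δ i j
  orthogonal′ i j = trans (mulT-negateFirstColumn H H i j) (orthogonal i j)

TwicePM1 : ℤ → Set
TwicePM1 x = ∃[ c ] (IsPM1 c × x ≡ + 2 * c)

TwicePM1⇒∣x∣≡2 : ∀ {x} → TwicePM1 x → ∣ x ∣ ≡ 2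
TwicePM1⇒∣x∣≡2 (_ , inj₁ refl , refl) = refl
TwicePM1⇒∣x∣≡2 (_ , inj₂ refl , refl) = refl

TwicePM1⇒x≡2mod4 : ∀ {x} → TwicePM1 x → ∃[ k ] (x ≡ + 4 * k + + 2)
TwicePM1⇒x≡2mod4 (_ , inj₁ refl , refl) = + 0 , refl
TwicePM1⇒x≡2mod4 (_ , inj₂ refl , refl) = -[1+ 0 ] , refl

MultipleOf4⇒x-2≡2mod4 : ∀ {x} → MultipleOf (+ 4) x → ∃[ k ] (x - + 2 ≡ + 4 * k + + 2)
MultipleOf4⇒x-2≡2mod4 (t , refl) = t - + 1 , shift t
  where
  shift : ∀ x → + 4 * x - + 2 ≡ + 4 * (x - + 1) + + 2
  shift = solve-∀

Unique⊆pair⇒length≤2 : ∀ {A : Set} {a b : A} (xs : List A) → Unique xs →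
                       (∀ {s} → s ∈ xs → s ≡ a ⊎ s ≡ b) → length xs ≤ 2
Unique⊆pair⇒length≤2 []          _ _ = z≤n
Unique⊆pair⇒length≤2 (_ ∷ [])     _ _ = s≤s z≤n
Unique⊆pair⇒length≤2 (_ ∷ _ ∷ []) _ _ = s≤s (s≤s z≤n)
Unique⊆pair⇒length≤2 {a = a} {b} (x ∷ y ∷ z ∷ _) ((x≢y ∷ x≢z ∷ _) ∷ (y≢z ∷ _) ∷ _) ⊆pair =
  ⊥-elim (pigeonhole (⊆pair (here refl)) (⊆pair (there (here refl)))
                     (⊆pair (there (there (here refl)))))
  where
  pigeonhole : x ≡ a ⊎ x ≡ b → y ≡ a ⊎ y ≡ b → z ≡ a ⊎ z ≡ b → ⊥
  pigeonhole (inj₁ p) (inj₁ q) _        = x≢y (trans p (sym q))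
  pigeonhole (inj₂ p) (inj₂ q) _        = x≢y (trans p (sym q))
  pigeonhole (inj₁ p) (inj₂ q) (inj₁ r) = x≢z (trans p (sym r))
  pigeonhole (inj₁ p) (inj₂ q) (inj₂ r) = y≢z (trans q (sym r))
  pigeonhole (inj₂ p) (inj₁ q) (inj₁ r) = y≢z (trans q (sym r))
  pigeonhole (inj₂ p) (inj₁ q) (inj₂ r) = x≢z (trans p (sym r))

module NegatedFirstColumn (m : ℕ) {H : Matrix (3 ℕ.+ m)}
                          (isHadamard : IsHadamard (3 ℕ.+ m) H) where

  n : ℕ
  n = 3 ℕ.+ m

  K : Matrix n
  K = negateFirstColumn H

  mulT-H-K : ∀ i j → mulT H K i j ≡ + n * δ i j - + 2 * (H i zero * H j zero)
  mulT-H-K i j = trans (mulT-negateFirstColumnʳ H H i j)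
                       (cong (_- + 2 * (H i zero * H j zero)) (proj₂ isHadamard i j))

  mulT-H-K-diagonal : ∀ i → mulT H K i i ≡ + (n ∸ 2)
  mulT-H-K-diagonal i = begin
    mulT H K i i                                 ≡⟨ mulT-H-K i i ⟩
    + n * δ i i - + 2 * (H i zero * H i zero)    ≡⟨ cong₂ (λ d h → + n * d - + 2 * h)
                                                          (δ-refl i)
                                                          (IsPM1⇒square≡1 (proj₁ isHadamard i zero)) ⟩
    + n * + 1 - + 2 * + 1                        ≡⟨ cong (_- + 2) (ℤ.*-identityʳ (+ n)) ⟩
    + (n ∸ 2)                                    ∎

  mulT-H-K-offDiagonal : ∀ i j → ¬ i ≡ j → TwicePM1 (mulT H K i j)
  mulT-H-K-offDiagonal i j i≢j =
    - c , IsPM1-- (IsPM1-* (proj₁ isHadamard i zero) (proj₁ isHadamard j zero)) , (begin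
      mulT H K i j              ≡⟨ mulT-H-K i j ⟩
      + n * δ i j - + 2 * c     ≡⟨ cong (λ d → + n * d - + 2 * c) (δ-≢ i j i≢j) ⟩
      + n * + 0 - + 2 * c       ≡⟨ simplify (+ n) c ⟩
      + 2 * - c                 ∎)
    where
    c : ℤ
    c = H i zero * H j zero
    simplify : ∀ x y → x * + 0 - + 2 * y ≡ + 2 * - y
    simplify = solve-∀

  ∣mulT-H-K-offDiagonal∣ : ∀ i j → ¬ i ≡ j → ∣ mulT H K i j ∣ ≡ 2
  ∣mulT-H-K-offDiagonal∣ i j i≢j = TwicePM1⇒∣x∣≡2 (mulT-H-K-offDiagonal i j i≢j)

  σ⊆pair : ∀ {s} → Inσ H K s → s ≡ 2 ⊎ s ≡ n ∸ 2
  σ⊆pair (i , j , refl) with i ≟ j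
  ... | yes refl = inj₂ (cong ∣_∣ (mulT-H-K-diagonal i))
  ... | no i≢j   = inj₁ (∣mulT-H-K-offDiagonal∣ i j i≢j)

  σ≡pair : σEqPair H K 2 (n ∸ 2)
  σ≡pair s = σ⊆pair , pair⊆σ
    where
    pair⊆σ : s ≡ 2 ⊎ s ≡ n ∸ 2 → Inσ H K s
    pair⊆σ (inj₁ refl) = zero , suc zero , ∣mulT-H-K-offDiagonal∣ zero (suc zero) λ ()
    pair⊆σ (inj₂ refl) = zero , zero , cong ∣_∣ (mulT-H-K-diagonal zero)

  mulT-H-K-diagonal≡2mod4 : ∀ i → ∃[ k ] (mulT H K i i ≡ + 4 * k + + 2)
  mulT-H-K-diagonal≡2mod4 i =
    map₂ (trans (mulT-H-K-diagonal i)) (MultipleOf4⇒x-2≡2mod4 (IsHadamard⇒4∣order m isHadamard))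

  mulT-H-K≡2mod4 : ∀ i j → ∃[ k ] (mulT H K i j ≡ + 4 * k + + 2)
  mulT-H-K≡2mod4 i j with i ≟ j
  ... | yes refl = mulT-H-K-diagonal≡2mod4 i
  ... | no i≢j   = TwicePM1⇒x≡2mod4 (mulT-H-K-offDiagonal i j i≢j)

  notUnbiased : ¬ n ≡ 4 → ¬ Unbiased H K
  notUnbiased n≢4 unbiased = n≢4 (begin
    n                                                      ≡⟨ unbiased zero (suc zero) ⟨
    ∣ mulT H K zero (suc zero) ∣ ℕ.* ∣ mulT H K zero (suc zero) ∣
      ≡⟨ cong (λ a → a ℕ.* a) (∣mulT-H-K-offDiagonal∣ zero (suc zero) λ ()) ⟩
    4                                                      ∎)

  weaklyUnbiased : ¬ n ≡ 4 → WeaklyUnbiased n H K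
  weaklyUnbiased n≢4 =
    isHadamard , negateFirstColumn-isHadamard isHadamard , mulT-H-K≡2mod4 ,
    (λ xs unique ⊆σ → Unique⊆pair⇒length≤2 xs unique (σ⊆pair ∘ ⊆σ)) ,
    notUnbiased n≢4

proposition6p3 : (n : ℕ) → 8 ≤ n → (∃[ H ] IsHadamard n H) →
    ∃[ H ] ∃[ K ] (WeaklyUnbiased n H K × σEqPair H K 2 (n ∸ 2))
proposition6p3 _ (s≤s (s≤s (s≤s (s≤s (s≤s (s≤s (s≤s (s≤s {n = r} z≤n)))))))) (H , isHadamard) =
  H , K , weaklyUnbiased (λ ()) , σ≡pair
  where open NegatedFirstColumn (5 ℕ.+ r) isHadamard
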